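{- Let $\ell>2$ be an integer and let $\lambda$ be an $(\ell,0)$-JM partition. Then there is no residue $i\in\mathbb{Z}/\ell\mathbb{Z}$ such that $\lambda$ has a removable box of residue $i$ and two distinct addable boxes of residue $i$.
   Context: Partitions are identified with Young diagrams; $(x,y)$ is the box in row $x$, column $y$, and its residue is $y-x \bmod \ell$. A removable box of $\lambda$ is a box of $\lambda$ whose removal leaves a partition; an addable box is a position not in $\lambda$ whose addition gives a partition. The hook length $h^\lambda_{(a,c)}$ of a box $(a,c)\in\lambda$ is the number of boxes of $\lambda$ to its right in its row or below it in its column, including itself. $\lambda$ is an $(\ell,0)$-JM partition if there do NOT exist boxes $(a,b)$, $(a,y)$, $(x,b)$ in $\lambda$ with $\ell\mid h^\lambda_{(a,b)}$, $\ell\nmid h^\lambda_{(a,y)}$, $\ell\nmid h^\lambda_{(x,b)}$. -}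

module Defs where

open import Data.Nat as ℕ using (ℕ; zero; suc; _+_; _∸_; _≤_; _<_; _≥_; _≤?_; NonZero)
open import Data.Integer as ℤ using (ℤ; +_; _%ℕ_)
open import Data.List using (List; []; _∷_; length; filter)
open import Data.List.Relation.Unary.All using (All)
open import Data.List.Relation.Unary.Linked using (Linked)
open import Data.Product using (Σ; _×_; _,_; ∃)
open import Data.Sum using (_⊎_)
open import Data.Nat.Divisibility using (_∣_)
open import Relation.Binary.PropositionalEquality using (_≡_)
open import Relation.Nullary using (¬_)
open import Function.Bundles using (_⇔_)

IsPartition : List ℕ → Set
IsPartition λ′ = All (λ p → 0 < p) λ′ × Linked _≥_ λ′

Partition : Set
Partition = Σ (List ℕ) IsPartition

-- Part x (rows are numbered from 1; part 0 and parts beyond the length are 0).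
part : List ℕ → ℕ → ℕ
part []       _             = 0
part (p ∷ ps) zero          = 0
part (p ∷ ps) (suc zero)    = p
part (p ∷ ps) (suc (suc x)) = part ps (suc x)

-- Boxes are pairs (row , column), both 1-indexed.
Box : Set
Box = ℕ × ℕ

_∈YD_ : Box → List ℕ → Set
(x , y) ∈YD λ′ = 1 ≤ x × 1 ≤ y × y ≤ part λ′ x

residue : (ℓ : ℕ) .{{_ : NonZero ℓ}} → Box → ℕ
residue ℓ (x , y) = ((+ y) ℤ.- (+ x)) %ℕ ℓ

Removable : List ℕ → Box → Set
Removable λ′ b = b ∈YD λ′ ×
  ∃ λ (μ : Partition) → ∀ c → (c ∈YD Data.Product.proj₁ μ) ⇔ (c ∈YD λ′ × ¬ c ≡ b)

Addable : List ℕ → Box → Set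
Addable λ′ b = ¬ (b ∈YD λ′) ×
  ∃ λ (μ : Partition) → ∀ c → (c ∈YD Data.Product.proj₁ μ) ⇔ (c ∈YD λ′ ⊎ c ≡ b)

colLength : List ℕ → ℕ → ℕ
colLength λ′ c = length (filter (c ≤?_) λ′)

hook : List ℕ → Box → ℕ
hook λ′ (a , c) = (part λ′ a ∸ c) + (colLength λ′ c ∸ a) + 1

IsJM : ℕ → List ℕ → Set
IsJM ℓ λ′ = ¬ (∃ λ a → ∃ λ b → ∃ λ x → ∃ λ y →
  (a , b) ∈YD λ′ × (a , y) ∈YD λ′ × (x , b) ∈YD λ′ ×
  ℓ ∣ hook λ′ (a , b) × ¬ (ℓ ∣ hook λ′ (a , y)) × ¬ (ℓ ∣ hook λ′ (x , b)))

module Submission where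

-- Let the removable box of residue i end row x, at (x , P x), where P k is the
-- length of row k.  An addable box always ends a row: it sits at (p , P p + 1),
-- so two distinct addable boxes of residue i lie in rows s < t.  Write b for the
-- column P t + 1 of the lower one; column b has exactly t - 1 boxes and column
-- P x has exactly x boxes.  The key formula (hook-content) expresses a hook
-- length as a difference of two contents,
--     hook (a , c) = content (a , P a + 1) - content (last box of column c),
-- so every hook below is, modulo ℓ, a difference of the three equal residues:
--   * hook (x , P x) = 1 and t ≠ x (else two contents differ by exactly 1);
--   * hook (s , b) ≡ -1 (mod ℓ);
--   * if x < t then hook (x , b) ≡ 0, and (x , b), (x , P x), (s , b) break JM;
--   * if x > t then hook (s , P x) ≡ 0, and (s , P x), (s , b), (x , P x) do.

open import Defs
open import Data.Nat using (ℕ; _<_; NonZero)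
open import Data.Fin using (Fin; toℕ)
open import Data.Product using (Σ; _×_; ∃; proj₁)
open import Relation.Binary.PropositionalEquality using (_≡_)
open import Relation.Nullary using (¬_)

open import Data.Nat using (zero; suc; _∸_; _≤_; _≥_; _≤?_; _≤′_; ≤′-refl; ≤′-step; z≤n; s≤s)
  renaming (_+_ to _+ℕ_)
import Data.Nat.Properties as ℕₚ
open import Data.Nat.Divisibility using (_∣_; ∣1⇒≡1)
open import Data.Integer using (ℤ; +_; -_; _+_; _-_; _*_; _%ℕ_; _/ℕ_)
import Data.Integer.Properties as ℤₚ
open import Data.Integer.DivMod using (a≡a%ℕn+[a/ℕn]*n)
open import Data.Integer.Divisibility.Signed
  using (divides; ∣ᵤ⇒∣; ∣⇒∣ᵤ; ∣m∣n⇒∣m-n; ∣m⇒∣-m) renaming (_∣_ to _∣ℤ_)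
open import Data.Integer.Tactic.RingSolver using (solve-∀)
open import Data.List using (List; []; _∷_)
open import Data.List.Properties using (filter-accept; filter-reject)
open import Data.List.Relation.Unary.Linked using (Linked; []; [-]; _∷_)
open import Data.Product using (_,_; proj₂)
open import Data.Sum using (inj₁; inj₂)
open import Data.Empty using (⊥; ⊥-elim)
open import Relation.Binary.Definitions using (tri<; tri≈; tri>)
open import Relation.Binary.PropositionalEquality using (refl; sym; trans; cong; cong₂; subst; module ≡-Reasoning)
open import Relation.Nullary using (yes; no)
open import Function.Bundles using (Equivalence)
open Equivalence using (to; from)

Decreasing : List ℕ → Set
Decreasing = Linked _≥_

part-step : ∀ {L} → Decreasing L → ∀ {k} → 1 ≤ k → part L (suc k) ≤ part L k
part-step []                       _ = z≤n
part-step [-]        {suc zero}    _ = z≤n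
part-step [-]        {suc (suc k)} _ = z≤n
part-step (p≥q ∷ _)  {suc zero}    _ = p≥q
part-step (_ ∷ rest) {suc (suc k)} _ = part-step rest (s≤s z≤n)

part-antitone : ∀ {L} → Decreasing L → ∀ {i j} → 1 ≤ i → i ≤ j → part L j ≤ part L i
part-antitone {L} dec {i} 1≤i i≤j = go (ℕₚ.≤⇒≤′ i≤j)
  where
  go : ∀ {j} → i ≤′ j → part L j ≤ part L i
  go ≤′-refl      = ℕₚ.≤-refl
  go (≤′-step i≤n) = ℕₚ.≤-trans (part-step dec (ℕₚ.≤-trans 1≤i (ℕₚ.≤′⇒≤ i≤n))) (go i≤n)

colLength-empty : ∀ {q qs c} → Decreasing (q ∷ qs) → q < c → colLength (q ∷ qs) c ≡ 0
colLength-empty {q} {[]}     {c} _         q<c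
  rewrite filter-reject (c ≤?_) {q} {[]} (ℕₚ.<⇒≱ q<c) = refl
colLength-empty {q} {r ∷ qs} {c} (q≥r ∷ d) q<c
  rewrite filter-reject (c ≤?_) {q} {r ∷ qs} (ℕₚ.<⇒≱ q<c) =
  colLength-empty d (ℕₚ.≤-<-trans q≥r q<c)

colLength-exact : ∀ {L} → Decreasing L → ∀ {c} k → 1 ≤ k →
  c ≤ part L k → part L (suc k) < c → colLength L c ≡ k
colLength-exact {[]}         _ k             _ c≤0 0<c = ⊥-elim (ℕₚ.<⇒≱ 0<c c≤0)
colLength-exact {p ∷ []}     _ {c} (suc zero) _ c≤p _
  rewrite filter-accept (c ≤?_) {p} {[]} c≤p = refl
colLength-exact {p ∷ q ∷ qs} (_ ∷ d) {c} (suc zero) _ c≤p q<c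
  rewrite filter-accept (c ≤?_) {p} {q ∷ qs} c≤p = cong suc (colLength-empty d q<c)
colLength-exact {p ∷ ps}     dec {c} (suc (suc k)) _ c≤P P<c
  rewrite filter-accept (c ≤?_) {p} {ps}
            (ℕₚ.≤-trans c≤P (part-antitone dec {1} {suc (suc k)} (s≤s z≤n) (s≤s z≤n))) =
  cong suc (colLength-exact (tail dec) (suc k) (s≤s z≤n) c≤P P<c)
  where
  tail : ∀ {x xs} → Decreasing (x ∷ xs) → Decreasing xs
  tail [-]     = []
  tail (_ ∷ d) = d

removable-corner : ∀ {L x y} → Removable L (x , y) → y ≡ part L x × part L (suc x) < y
removable-corner {L} {x} {y} ((1≤x , 1≤y , y≤P) , (M , _ , decM) , M≡L-r) = ends-row , next-shorter
  where
  r∉M : ¬ ((x , y) ∈YD M)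
  r∉M r∈M = proj₂ (to (M≡L-r (x , y)) r∈M) refl
  ends-row : y ≡ part L x
  ends-row with ℕₚ.m≤n⇒m<n∨m≡n y≤P
  ... | inj₂ y≡P = y≡P
  ... | inj₁ y<P = ⊥-elim (r∉M (1≤x , 1≤y , ℕₚ.≤-trans (ℕₚ.n≤1+n y) right∈M))
    where
    right∈M : suc y ≤ part M x
    right∈M = proj₂ (proj₂ (from (M≡L-r (x , suc y)) ((1≤x , s≤s z≤n , y<P) , λ ())))
  next-shorter : part L (suc x) < y
  next-shorter with y ≤? part L (suc x)
  ... | no y≰P = ℕₚ.≰⇒> y≰P
  ... | yes y≤P′ = ⊥-elim (r∉M (1≤x , 1≤y , ℕₚ.≤-trans below∈M (part-step decM 1≤x)))
    where
    below∈M : y ≤ part M (suc x)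
    below∈M = proj₂ (proj₂ (from (M≡L-r (suc x , y))
      ((s≤s z≤n , 1≤y , y≤P′) , λ e → ℕₚ.1+n≢n (cong proj₁ e))))

addable-corner : ∀ {L p c} → Addable L (p , c) →
  1 ≤ p × c ≡ suc (part L p) × (∀ {k} → p ≡ suc k → 1 ≤ k → c ≤ part L k)
addable-corner {L} {p} {c} (a∉L , (M , _ , decM) , M≡L+a) = 1≤p , ends-row , row-above
  where
  a∈M : (p , c) ∈YD M
  a∈M = from (M≡L+a (p , c)) (inj₂ refl)
  1≤p : 1 ≤ p
  1≤p = proj₁ a∈M
  1≤c : 1 ≤ c
  1≤c = proj₁ (proj₂ a∈M)
  c≤M : c ≤ part M p
  c≤M = proj₂ (proj₂ a∈M)
  P<c : part L p < c
  P<c with c ≤? part L p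
  ... | yes c≤P = ⊥-elim (a∉L (1≤p , 1≤c , c≤P))
  ... | no c≰P  = ℕₚ.≰⇒> c≰P
  -- Every position of row p left of c is in M, hence already in L.
  ends-row : c ≡ suc (part L p)
  ends-row with ℕₚ.m≤n⇒m<n∨m≡n P<c
  ... | inj₂ e = sym e
  ... | inj₁ (s≤s {n = c′} 1+P≤c′) with to (M≡L+a (p , c′))
      (1≤p , ℕₚ.≤-trans (s≤s z≤n) 1+P≤c′ , ℕₚ.≤-trans (ℕₚ.n≤1+n c′) c≤M)
  ...   | inj₁ (_ , _ , c′≤P) = ⊥-elim (ℕₚ.<⇒≱ 1+P≤c′ c′≤P)
  ...   | inj₂ e              = ⊥-elim (ℕₚ.1+n≢n (sym (cong proj₂ e)))
  row-above : ∀ {k} → p ≡ suc k → 1 ≤ k → c ≤ part L k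
  row-above {k} refl 1≤k with c ≤? part L k
  ... | yes c≤P = c≤P
  ... | no c≰P with to (M≡L+a (k , c)) (1≤k , 1≤c , ℕₚ.≤-trans c≤M (part-step decM 1≤k))
  ...   | inj₁ (_ , _ , c≤P) = ⊥-elim (c≰P c≤P)
  ...   | inj₂ e             = ⊥-elim (ℕₚ.1+n≢n (sym (cong proj₁ e)))

content : Box → ℤ
content (x , y) = + y - + x

pos-∸ : ∀ {m n} → n ≤ m → + (m ∸ n) ≡ + m - + n
pos-∸ {m} {n} n≤m = sym (trans (ℤₚ.m-n≡m⊖n m n) (ℤₚ.⊖-≥ n≤m))

hook-content : ∀ L {a c k} → c ≤ part L a → a ≤ k → colLength L c ≡ k →
  + hook L (a , c) ≡ content (a , suc (part L a)) - content (k , c)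
hook-content L {a} {c} {k} c≤P a≤k refl = begin
  + (P ∸ c +ℕ (k ∸ a) +ℕ 1)      ≡⟨ ℤₚ.pos-+ (P ∸ c +ℕ (k ∸ a)) 1 ⟩
  + (P ∸ c +ℕ (k ∸ a)) + + 1      ≡⟨ cong (_+ + 1) (ℤₚ.pos-+ (P ∸ c) (k ∸ a)) ⟩
  + (P ∸ c) + + (k ∸ a) + + 1      ≡⟨ cong₂ (λ u v → u + v + + 1) (pos-∸ c≤P) (pos-∸ a≤k) ⟩
  (+ P - + c) + (+ k - + a) + + 1  ≡⟨ regroup (+ P) (+ a) (+ c) (+ k) ⟩
  (+ 1 + + P - + a) - (+ c - + k)  ∎
  where
  open ≡-Reasoning
  P = part L a
  regroup : ∀ P a c k → (P - c) + (k - a) + + 1 ≡ (+ 1 + P - a) - (c - k)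
  regroup = solve-∀

hook-corner : ∀ {L x} → Decreasing L → 1 ≤ x → part L (suc x) < part L x →
  hook L (x , part L x) ≡ 1
hook-corner {L} {x} dec 1≤x corner
  rewrite colLength-exact dec x 1≤x ℕₚ.≤-refl corner | ℕₚ.n∸n≡0 (part L x) | ℕₚ.n∸n≡0 x = refl

%ℕ-≡⇒∣- : ∀ ℓ .{{_ : NonZero ℓ}} m n → m %ℕ ℓ ≡ n %ℕ ℓ → + ℓ ∣ℤ m - n
%ℕ-≡⇒∣- ℓ m n m≡n = divides (m /ℕ ℓ - n /ℕ ℓ) (begin
  m - n                                                        ≡⟨ cong₂ _-_ (a≡a%ℕn+[a/ℕn]*n m ℓ) (a≡a%ℕn+[a/ℕn]*n n ℓ) ⟩
  (+ (m %ℕ ℓ) + m /ℕ ℓ * + ℓ) - (+ (n %ℕ ℓ) + n /ℕ ℓ * + ℓ)    ≡⟨ cong (λ r → (+ (m %ℕ ℓ) + m /ℕ ℓ * + ℓ) - (+ r + n /ℕ ℓ * + ℓ)) (sym m≡n) ⟩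
  (+ (m %ℕ ℓ) + m /ℕ ℓ * + ℓ) - (+ (m %ℕ ℓ) + n /ℕ ℓ * + ℓ)    ≡⟨ cancel (+ (m %ℕ ℓ)) (m /ℕ ℓ) (n /ℕ ℓ) (+ ℓ) ⟩
  (m /ℕ ℓ - n /ℕ ℓ) * + ℓ                                      ∎)
  where
  open ≡-Reasoning
  cancel : ∀ r p q l → (r + p * l) - (r + q * l) ≡ (p - q) * l
  cancel = solve-∀

ℓ∤1 : ∀ {ℓ} → 1 < ℓ → ¬ (ℓ ∣ 1)
ℓ∤1 1<ℓ ℓ∣1 = ℕₚ.<-irrefl (sym (∣1⇒≡1 ℓ∣1)) 1<ℓ

ℓ∤-1 : ∀ {ℓ} → 1 < ℓ → ¬ (+ ℓ ∣ℤ - + 1)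
ℓ∤-1 1<ℓ ℓ∣-1 = ℓ∤1 1<ℓ (∣⇒∣ᵤ ℓ∣-1)

∣⇒∤-1 : ∀ {ℓ D} → 1 < ℓ → + ℓ ∣ℤ D → ¬ (+ ℓ ∣ℤ D - + 1)
∣⇒∤-1 {ℓ} {D} 1<ℓ ℓ∣D ℓ∣D-1 = ℓ∤-1 1<ℓ (subst (+ ℓ ∣ℤ_) (difference D) (∣m∣n⇒∣m-n ℓ∣D-1 ℓ∣D))
  where
  difference : ∀ D → (D - + 1) - D ≡ - + 1
  difference = solve-∀

module RemovableCorner (ℓ : ℕ) .{{_ : NonZero ℓ}} (1<ℓ : 1 < ℓ)
  {L : List ℕ} (dec : Decreasing L) (jm : IsJM ℓ L)
  {x : ℕ} (1≤x : 1 ≤ x) (corner : part L (suc x) < part L x) where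

  ρ : ℤ
  ρ = content (x , part L x)

  record CongruentAddableRow (p : ℕ) : Set where
    field
      positive   : 1 ≤ p
      row-above  : ∀ {k} → p ≡ suc k → 1 ≤ k → suc (part L p) ≤ part L k
      congruent  : + ℓ ∣ℤ ρ - content (p , suc (part L p))
  open CongruentAddableRow

  congruent-row : ∀ {p c} → Addable L (p , c) → residue ℓ (p , c) ≡ residue ℓ (x , part L x) →
    c ≡ suc (part L p) × CongruentAddableRow p
  congruent-row {p} {c} add res with addable-corner {L} add
  ... | 1≤p , refl , above =
    refl , record { positive = 1≤p ; row-above = above
                  ; congruent = %ℕ-≡⇒∣- ℓ ρ (content (p , c)) (sym res) }

  -- The addable box of row x has content ρ + 1, so it is not congruent to ρ.
  removable-row-incongruent : ¬ CongruentAddableRow x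
  removable-row-incongruent X = ℓ∤-1 1<ℓ (subst (+ ℓ ∣ℤ_) (off-by-one (+ part L x) (+ x)) (congruent X))
    where
    off-by-one : ∀ P x → (P - x) - (+ 1 + P - x) ≡ - + 1
    off-by-one = solve-∀

  module TwoRows {s t} (s≤t : s ≤ t) (S : CongruentAddableRow s) (T : CongruentAddableRow (suc t)) where

    Px Ps : ℕ
    Px = part L x
    Ps = part L s

    b : ℕ
    b = suc (part L (suc t))

    1≤s : 1 ≤ s
    1≤s = positive S
    1≤t : 1 ≤ t
    1≤t = ℕₚ.≤-trans 1≤s s≤t
    1≤Px : 1 ≤ Px
    1≤Px = ℕₚ.≤-trans (s≤s z≤n) corner
    b≤Pt : b ≤ part L t
    b≤Pt = row-above T refl 1≤t
    b≤Ps : b ≤ Ps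
    b≤Ps = ℕₚ.≤-trans b≤Pt (part-antitone dec 1≤s s≤t)

    column-b : colLength L b ≡ t
    column-b = colLength-exact dec t 1≤t b≤Pt ℕₚ.≤-refl

    column-Px : colLength L Px ≡ x
    column-Px = colLength-exact dec x 1≤x ℕₚ.≤-refl corner

    x-corner∤ : ¬ (ℓ ∣ hook L (x , Px))
    x-corner∤ ℓ∣h = ℓ∤1 1<ℓ (subst (ℓ ∣_) (hook-corner dec 1≤x corner) ℓ∣h)

    -- hook (s , b) ≡ -1 modulo ℓ.
    s-b∤ : ¬ (ℓ ∣ hook L (s , b))
    s-b∤ ℓ∣h = ∣⇒∤-1 1<ℓ (∣m∣n⇒∣m-n (congruent T) (congruent S))
      (subst (+ ℓ ∣ℤ_) hook≡ (∣ᵤ⇒∣ ℓ∣h))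
      where
      regroup : ∀ ρ Ps s Pt t → (+ 1 + Ps - s) - (+ 1 + Pt - t)
        ≡ ((ρ - (+ 1 + Pt - (+ 1 + t))) - (ρ - (+ 1 + Ps - s))) - + 1
      regroup = solve-∀
      hook≡ : + hook L (s , b) ≡ ((ρ - content (suc t , b)) - (ρ - content (s , suc Ps))) - + 1
      hook≡ = trans (hook-content L b≤Ps s≤t column-b) (regroup ρ (+ Ps) (+ s) (+ part L (suc t)) (+ t))

    -- x < t + 1: the box (x , b) has hook ≡ 0, while (x , Px) and (s , b) do not.
    removable-above : x < suc t → ⊥
    removable-above (s≤s x≤t) = jm (x , b , s , Px , (1≤x , s≤s z≤n , b≤Px) , (1≤x , 1≤Px , ℕₚ.≤-refl)
                                     , (1≤s , s≤s z≤n , b≤Ps) , x-b∣ , x-corner∤ , s-b∤)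
      where
      b≤Px : b ≤ Px
      b≤Px = ℕₚ.≤-trans b≤Pt (part-antitone dec 1≤x x≤t)
      regroup : ∀ Px x Pt t → (+ 1 + Px - x) - (+ 1 + Pt - t) ≡ (Px - x) - (+ 1 + Pt - (+ 1 + t))
      regroup = solve-∀
      x-b∣ : ℓ ∣ hook L (x , b)
      x-b∣ = ∣⇒∣ᵤ (subst (+ ℓ ∣ℤ_)
        (sym (trans (hook-content L b≤Px x≤t column-b) (regroup (+ Px) (+ x) (+ part L (suc t)) (+ t))))
        (congruent T))

    -- t + 1 < x: the box (s , Px) has hook ≡ 0, while (s , b) and (x , Px) do not.
    removable-below : suc t < x → ⊥
    removable-below t<x = jm (s , Px , x , b , (1≤s , 1≤Px , Px≤Ps) , (1≤s , s≤s z≤n , b≤Ps)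
                              , (1≤x , 1≤Px , ℕₚ.≤-refl) , s-Px∣ , s-b∤ , x-corner∤)
      where
      s≤x : s ≤ x
      s≤x = ℕₚ.≤-trans s≤t (ℕₚ.≤-trans (ℕₚ.n≤1+n t) (ℕₚ.<⇒≤ t<x))
      Px≤Ps : Px ≤ Ps
      Px≤Ps = part-antitone dec 1≤s s≤x
      regroup : ∀ Ps s Px x → (+ 1 + Ps - s) - (Px - x) ≡ - ((Px - x) - (+ 1 + Ps - s))
      regroup = solve-∀
      s-Px∣ : ℓ ∣ hook L (s , Px)
      s-Px∣ = ∣⇒∣ᵤ (subst (+ ℓ ∣ℤ_)
        (sym (trans (hook-content L Px≤Ps s≤x column-Px) (regroup (+ Ps) (+ s) (+ Px) (+ x))))
        (∣m⇒∣-m (congruent S)))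

    contradiction : ⊥
    contradiction with ℕₚ.<-cmp x (suc t)
    ... | tri< x<t _ _  = removable-above x<t
    ... | tri≈ _ refl _ = removable-row-incongruent T
    ... | tri> _ _ t<x  = removable-below t<x

  congruent-addable-unique : ∀ {a₁ a₂} →
    Addable L a₁ → residue ℓ a₁ ≡ residue ℓ (x , part L x) →
    Addable L a₂ → residue ℓ a₂ ≡ residue ℓ (x , part L x) → a₁ ≡ a₂
  congruent-addable-unique {p₁ , c₁} {p₂ , c₂} add₁ res₁ add₂ res₂
    with congruent-row add₁ res₁ | congruent-row add₂ res₂ | ℕₚ.<-cmp p₁ p₂
  ... | refl , R₁ | refl , R₂ | tri< (s≤s p₁≤p) _ _ = ⊥-elim (TwoRows.contradiction p₁≤p R₁ R₂)
  ... | refl , _  | refl , _  | tri≈ _ refl _       = refl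
  ... | refl , R₁ | refl , R₂ | tri> _ _ (s≤s p₂≤p) = ⊥-elim (TwoRows.contradiction p₂≤p R₂ R₁)

lemma2p8 : (ℓ : ℕ) .{{_ : NonZero ℓ}} → 2 < ℓ → (λp : Partition) → IsJM ℓ (proj₁ λp) →
  ¬ (∃ λ (i : Fin ℓ) →
      (∃ λ r → Removable (proj₁ λp) r × residue ℓ r ≡ toℕ i) ×
      (∃ λ a₁ → ∃ λ a₂ → ¬ a₁ ≡ a₂ ×
        Addable (proj₁ λp) a₁ × residue ℓ a₁ ≡ toℕ i ×
        Addable (proj₁ λp) a₂ × residue ℓ a₂ ≡ toℕ i))
lemma2p8 ℓ 2<ℓ (L , _ , dec) jm
  (i , ((x , y) , removable , res-r) , a₁ , a₂ , a₁≢a₂ , add₁ , res₁ , add₂ , res₂)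
  with removable-corner {L} removable
... | refl , corner =
  a₁≢a₂ (congruent-addable-unique add₁ (trans res₁ (sym res-r)) add₂ (trans res₂ (sym res-r)))
  where
  open RemovableCorner ℓ (ℕₚ.<-trans (ℕₚ.n<1+n 1) 2<ℓ) dec jm (proj₁ (proj₁ removable)) corner
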